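{- Let $G$ be a graph and let $k\geq 2$ and $n\geq 3$ be integers. If $\mathsf{TS}_k(G)$ contains the complete graph $K_n$ as a subgraph, then so does $G$.
   Context: All graphs are finite, simple and undirected. An independent set of a graph is a set of pairwise non-adjacent vertices. For a positive integer $k$, $\mathsf{TS}_k(G)$ is the graph whose vertices are the independent sets of $G$ of size exactly $k$, where two such sets $I,J$ are adjacent iff there exist $u,v\in V(G)$ with $I\setminus J=\{u\}$, $J\setminus I=\{v\}$ and $uv\in E(G)$. -}

module Defs where

open import Data.Nat using (ℕ)
open import Data.Fin using (Fin)
open import Data.Fin.Subset using (Subset; _∈_; _─_; ⁅_⁆; ∣_∣)
open import Data.Product using (Σ; ∃; ∃-syntax; _×_; _,_; proj₁)
open import Relation.Binary.PropositionalEquality using (_≡_)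
open import Relation.Nullary using (¬_)

record Graph : Set₁ where
  field
    m     : ℕ
    E     : Fin m → Fin m → Set
    sym   : ∀ {u v} → E u v → E v u
    irrefl : ∀ {u} → ¬ E u u

open Graph

Independent : (G : Graph) → Subset (m G) → Set
Independent G I = ∀ {u v} → u ∈ I → v ∈ I → ¬ E G u v

TSVertex : Graph → ℕ → Set
TSVertex G k = Σ (Subset (m G)) (λ I → Independent G I × ∣ I ∣ ≡ k)

TSAdj : (G : Graph) (k : ℕ) → TSVertex G k → TSVertex G k → Set
TSAdj G k (I , _) (J , _) =
  ∃[ u ] ∃[ v ] ((I ─ J) ≡ ⁅ u ⁆ × (J ─ I) ≡ ⁅ v ⁆ × E G u v)

ContainsKG : Graph → ℕ → Set
ContainsKG G n =
  Σ (Fin n → Fin (m G)) λ f →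
    (∀ i j → f i ≡ f j → i ≡ j) × (∀ i j → ¬ i ≡ j → E G (f i) (f j))

-- Vertices of TS_k(G) are the sets themselves, so
-- distinctness of vertices is distinctness of the underlying subsets.
ContainsKTS : Graph → ℕ → ℕ → Set
ContainsKTS G k n =
  Σ (Fin n → TSVertex G k) λ f →
    (∀ i j → proj₁ (f i) ≡ proj₁ (f j) → i ≡ j)
    × (∀ i j → ¬ i ≡ j → TSAdj G k (f i) (f j))

-- Write I₀, …, I_{n-1} for the independent sets forming the clique in TS_k(G).
-- For i ≠ j the move I_i → I_j removes one vertex u and adds a neighbour v of u.
-- The removed vertex does not depend on j: if I_i lost u towards I_j but some
-- w ≠ u towards I_l, then u ∈ I_l and w ∈ I_j; since I_l is independent, v ∉ I_l,
-- so both v and w would be the single vertex of I_j ∖ I_l, contradicting w ∈ I_i ∌ v.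
-- Calling this vertex f(i), the move I_i → I_j swaps f(i) for f(j), so f(i) f(j)
-- is an edge of G, and f is injective because G has no loops.
module Submission where

open import Defs
open import Data.Nat as ℕ using (ℕ; _≤_; s≤s)
open import Data.Fin using (Fin; zero; suc; _≟_)
open import Data.Fin.Subset using (Subset; _∈_; _∉_; _─_; ⁅_⁆)
open import Data.Fin.Subset.Properties
  using (_∈?_; x∈⁅x⁆; x∈⁅y⁆⇒x≡y; p─q⊆p; x∈p∧x∉q⇒x∈p─q)
open import Data.Vec using (_∷_; there)
open import Data.Product using (_,_; proj₁; proj₂)
open import Data.Empty using (⊥)
open import Relation.Nullary using (¬_; yes; no; contradiction)
open import Relation.Nullary.Decidable using (decidable-stable)
open import Relation.Binary.PropositionalEquality
  using (_≡_; _≢_; refl; sym; trans; subst; subst₂)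

private
  variable
    m : ℕ
    p q : Subset m
    u x : Fin m

x∈p─q⇒x∉q : ∀ (p q : Subset m) → x ∈ p ─ q → x ∉ q
x∈p─q⇒x∉q (_ ∷ p) (_ ∷ q) (there x∈p─q) (there x∈q) = x∈p─q⇒x∉q p q x∈p─q x∈q

module SingletonDifference (p─q≡⁅u⁆ : p ─ q ≡ ⁅ u ⁆) where

  private
    u∈p─q : u ∈ p ─ q
    u∈p─q = subst (u ∈_) (sym p─q≡⁅u⁆) (x∈⁅x⁆ u)

  u∈p : u ∈ p
  u∈p = p─q⊆p p q u∈p─q

  u∉q : u ∉ q
  u∉q = x∈p─q⇒x∉q p q u∈p─q

  x∈p∧x∉q⇒x≡u : x ∈ p → x ∉ q → x ≡ u
  x∈p∧x∉q⇒x≡u x∈p x∉q =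
    x∈⁅y⁆⇒x≡y u (subst (_ ∈_) p─q≡⁅u⁆ (x∈p∧x∉q⇒x∈p─q x∈p x∉q))

  u-unique : p ─ q ≡ ⁅ x ⁆ → x ≡ u
  u-unique {x = x} p─q≡⁅x⁆ =
    x∈⁅y⁆⇒x≡y u (subst (x ∈_) (trans (sym p─q≡⁅x⁆) p─q≡⁅u⁆) (x∈⁅x⁆ x))

  x∈p∧x≢u⇒x∈q : x ∈ p → x ≢ u → x ∈ q
  x∈p∧x≢u⇒x∈q {x = x} x∈p x≢u with x ∈? q
  ... | yes x∈q = x∈q
  ... | no  x∉q = contradiction (x∈p∧x∉q⇒x≡u x∈p x∉q) x≢u

removed-vertex-unique : ∀ (G : Graph) {I J L : Subset (Graph.m G)} {u v w a} →
  Independent G L →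
  I ─ J ≡ ⁅ u ⁆ → J ─ I ≡ ⁅ v ⁆ → Graph.E G u v →
  I ─ L ≡ ⁅ w ⁆ → J ─ L ≡ ⁅ a ⁆ →
  u ≡ w
removed-vertex-unique G {I} {J} {L} {u} {v} {w} L-indep I─J J─I uv I─L J─L =
  decidable-stable (u ≟ w) u≢w⇒⊥
  where
  module IJ = SingletonDifference I─J
  module JI = SingletonDifference J─I
  module IL = SingletonDifference I─L
  module JL = SingletonDifference J─L

  u∈I : u ∈ I
  u∈I = IJ.u∈p
  v∈J : v ∈ J
  v∈J = JI.u∈p
  v∉I : v ∉ I
  v∉I = JI.u∉q
  w∈I : w ∈ I
  w∈I = IL.u∈p
  w∉L : w ∉ L
  w∉L = IL.u∉q

  u≢w⇒⊥ : u ≢ w → ⊥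
  u≢w⇒⊥ u≢w with v ∈? L
  ... | yes v∈L = L-indep (IL.x∈p∧x≢u⇒x∈q u∈I u≢w) v∈L uv
  ... | no  v∉L = v∉I (subst (_∈ I) w≡v w∈I)
    where
    w∈J : w ∈ J
    w∈J = IJ.x∈p∧x≢u⇒x∈q w∈I (λ w≡u → u≢w (sym w≡u))

    w≡v : w ≡ v
    w≡v = trans (JL.x∈p∧x∉q⇒x≡u w∈J w∉L) (sym (JL.x∈p∧x∉q⇒x≡u v∈J v∉L))

module TSClique (G : Graph) {k n : ℕ} (F : Fin n → TSVertex G k)
                (F-adjacent : ∀ i j → ¬ i ≡ j → TSAdj G k (F i) (F j)) where

  open Graph G using (E)

  I : Fin n → Subset (Graph.m G)
  I i = proj₁ (F i)

  removed-unique : ∀ {i j l u w} → i ≢ j →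
    I i ─ I j ≡ ⁅ u ⁆ → I i ─ I l ≡ ⁅ w ⁆ → u ≡ w
  removed-unique {i} {j} {l} i≢j Ii─Ij Ii─Il with j ≟ l
  ... | yes refl = SingletonDifference.u-unique Ii─Il Ii─Ij
  ... | no j≢l with F-adjacent i j i≢j | F-adjacent j l j≢l
  ... | _ , v , Ii─Ij′ , Ij─Ii , u′v | _ , _ , Ij─Il , _ , _ =
    removed-vertex-unique G (proj₁ (proj₂ (F l)))
      Ii─Ij Ij─Ii (subst (λ x → E x v) (SingletonDifference.u-unique Ii─Ij Ii─Ij′) u′v)
      Ii─Il Ij─Il

  module Representatives (other : Fin n → Fin n) (other≢ : ∀ i → i ≢ other i) where

    f : Fin n → Fin (Graph.m G)
    f i = proj₁ (F-adjacent i (other i) (other≢ i))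

    Ii─Iother≡⁅fi⁆ : ∀ i → I i ─ I (other i) ≡ ⁅ f i ⁆
    Ii─Iother≡⁅fi⁆ i = proj₁ (proj₂ (proj₂ (F-adjacent i (other i) (other≢ i))))

    f-adjacent : ∀ i j → ¬ i ≡ j → E (f i) (f j)
    f-adjacent i j i≢j with F-adjacent i j i≢j
    ... | u , v , Ii─Ij , Ij─Ii , uv =
      subst₂ E (removed-unique i≢j Ii─Ij (Ii─Iother≡⁅fi⁆ i))
               (removed-unique (λ j≡i → i≢j (sym j≡i)) Ij─Ii (Ii─Iother≡⁅fi⁆ j))
               uv

    f-injective : ∀ i j → f i ≡ f j → i ≡ j
    f-injective i j fi≡fj with i ≟ j
    ... | yes i≡j = i≡j
    ... | no  i≢j = contradiction (subst (E (f i)) (sym fi≡fj) (f-adjacent i j i≢j)) (Graph.irrefl G)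

lemma2 : (G : Graph) (k n : ℕ) → 2 ≤ k → 3 ≤ n → ContainsKTS G k n → ContainsKG G n
lemma2 G k 0 _ () _
lemma2 G k 1 _ (s≤s ()) _
lemma2 G k (ℕ.suc (ℕ.suc n)) _ _ (F , _ , F-adjacent) = f , f-injective , f-adjacent
  where
  other : Fin (ℕ.suc (ℕ.suc n)) → Fin (ℕ.suc (ℕ.suc n))
  other zero    = suc zero
  other (suc _) = zero

  other≢ : ∀ i → i ≢ other i
  other≢ zero    ()
  other≢ (suc _) ()

  open TSClique G F F-adjacent
  open Representatives other other≢
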